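{- Let $P$ be a rooted tree poset with $n$ elements. Then $n\leq\deg(\partial)$, with equality if and only if $P$ is a rooted star poset.
   Context: A labeling of an $n$-element poset $P$ is a bijection $L:P\to[n]$; $\Lambda(P)$ denotes the set of labelings. Extended promotion $\partial:\Lambda(P)\to\Lambda(P)$: for a labeling $L$, the promotion chain is $v_1=L^{ -1}(1)$, and $v_{i+1}$ is the element above $v_i$ with smallest label, stopping at the first maximal element $v_m$; then $\partial(L)(x)=L(x)-1$ for $x$ off the chain, $\partial(L)(v_i)=L(v_{i+1})-1$ for $i<m$, $\partial(L)(v_m)=n$. The degree of noninvertibility of $f:X\to X$ ($X$ finite) is $\deg(f)=\frac{1}{|X|}\sum_{x\in X}|f^{ -1}(x)|^2$; here $\deg(\partial)$ is taken with $X=\Lambda(P)$. A rooted tree poset is a connected poset in which each element is covered by at most one other element; a rooted star poset is a rooted tree poset whose root covers every leaf. -}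

module Defs where

open import Data.Nat as ℕ using (ℕ; zero; suc; _+_; _*_; _∸_; _≡ᵇ_)
open import Data.Bool using (Bool; true; false; _∧_; not; if_then_else_)
open import Data.Fin using (Fin)
open import Data.Fin.Properties using () renaming (_≟_ to _≟ᶠ_)
open import Data.List as List using (List; []; _∷_; filter; length; allFin; upTo; map; concatMap)
open import Data.Bool.ListAction using (all)
open import Data.Nat.ListAction using (sum)
open import Data.Vec as Vec using (Vec; lookup)
open import Data.Vec.Properties using () renaming (≡-dec to ≡-decᵛ)
open import Data.Maybe using (Maybe; just; nothing)
open import Data.Product using (Σ; ∃; _×_; _,_)
open import Relation.Binary.PropositionalEquality using (_≡_; _≢_)
open import Relation.Binary.Structures using (IsDecPartialOrder)
open import Relation.Binary.Construct.Closure.ReflexiveTransitive using (Star)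
open import Relation.Nullary using (¬_; does)
open import Data.Sum using (_⊎_)
open import Level using (0ℓ)

record FinPoset (n : ℕ) : Set₁ where
  field
    _≼_ : Fin n → Fin n → Set
    isDecPartialOrder : IsDecPartialOrder _≡_ _≼_

  open IsDecPartialOrder isDecPartialOrder public using (_≤?_)

  _≺_ : Fin n → Fin n → Set
  x ≺ y = x ≼ y × x ≢ y

  _⋖_ : Fin n → Fin n → Set
  x ⋖ y = x ≺ y × (∀ z → ¬ (x ≺ z × z ≺ y))

  Maximal : Fin n → Set
  Maximal x = ∀ y → ¬ (x ≺ y)

  Minimal : Fin n → Set
  Minimal x = ∀ y → ¬ (y ≺ x)

  Comparable : Fin n → Fin n → Set
  Comparable x y = x ≼ y ⊎ y ≼ x

  Connected : Set
  Connected = ∀ x y → Star Comparable x y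

  IsRootedTree : Set
  IsRootedTree = Connected × (∀ x y z → x ⋖ y → x ⋖ z → y ≡ z)

  IsRootedStar : Set
  IsRootedStar = IsRootedTree ×
    (∃ λ r → Maximal r × (∀ x → Minimal x → x ≢ r → x ⋖ r))

  -- Computational part: labelings and extended promotion.
  -- A labeling is represented as a vector L with L[x] ∈ {1,…,n}, injective.

  ltᵇ : Fin n → Fin n → Bool
  ltᵇ x y = does (x ≤? y) ∧ not (does (x ≟ᶠ y))

  above : Fin n → List (Fin n)
  above v = filter (λ y → x≺? v y) (allFin n)
    where
    open import Relation.Nullary using (Dec; yes; no)
    open import Data.Bool using (T)
    open import Relation.Nullary.Decidable using (T?)
    x≺? : ∀ a b → Dec (T (ltᵇ a b))
    x≺? a b = T? (ltᵇ a b)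

  minByLabel : Vec ℕ n → List (Fin n) → Maybe (Fin n)
  minByLabel L [] = nothing
  minByLabel L (x ∷ xs) with minByLabel L xs
  ... | nothing = just x
  ... | just y = if lookup L x ℕ.≤ᵇ lookup L y then just x else just y

  -- promotion chain starting at v (fuel bounds its length; n steps suffice)
  chainFrom : ℕ → Vec ℕ n → Fin n → List (Fin n)
  chainFrom zero L v = v ∷ []
  chainFrom (suc k) L v with minByLabel L (above v)
  ... | nothing = v ∷ []
  ... | just w = v ∷ chainFrom k L w

  -- position of x in chain: nothing = off chain; just nothing = last;
  -- just (just y) = followed by y
  succIn : List (Fin n) → Fin n → Maybe (Maybe (Fin n))
  succIn [] x = nothing
  succIn (a ∷ []) x = if does (a ≟ᶠ x) then just nothing else nothing
  succIn (a ∷ b ∷ cs) x = if does (a ≟ᶠ x) then just (just b) else succIn (b ∷ cs) x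

  findLabel1 : Vec ℕ n → List (Fin n) → Maybe (Fin n)
  findLabel1 L [] = nothing
  findLabel1 L (x ∷ xs) = if lookup L x ≡ᵇ 1 then just x else findLabel1 L xs

  ∂ : Vec ℕ n → Vec ℕ n
  ∂ L with findLabel1 L (allFin n)
  ... | nothing = L
  ... | just v₁ = Vec.tabulate new
    where
    ch = chainFrom n L v₁
    new : Fin n → ℕ
    new x with succIn ch x
    ... | nothing = lookup L x ∸ 1
    ... | just nothing = n
    ... | just (just y) = lookup L y ∸ 1

allVecs : (vals : List ℕ) → (k : ℕ) → List (Vec ℕ k)
allVecs vals zero = Vec.[] ∷ []
allVecs vals (suc k) = concatMap (λ a → map (a Vec.∷_) (allVecs vals k)) vals

isLabelingᵇ : {n : ℕ} → Vec ℕ n → Bool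
isLabelingᵇ {n} L =
  all (λ i → all (λ j → not (lookup L i ≡ᵇ lookup L j) ∨' does (i ≟ᶠ j)) (allFin n)) (allFin n)
  where
  _∨'_ : Bool → Bool → Bool
  true ∨' b = true
  false ∨' b = b

Λ : (n : ℕ) → List (Vec ℕ n)
Λ n = List.filter (λ L → Relation.Nullary.Decidable.T? (isLabelingᵇ L))
        (allVecs (map suc (upTo n)) n)
  where import Relation.Nullary.Decidable

-- |f⁻¹(x)| for x in X (X given as a list without repetitions)
preimageSize : {n : ℕ} → (Vec ℕ n → Vec ℕ n) → List (Vec ℕ n) → Vec ℕ n → ℕ
preimageSize f X x = length (filter (λ y → ≡-decᵛ ℕ._≟_ (f y) x) X)

-- |X| · deg(f) = Σ_{x ∈ X} |f⁻¹(x)|²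
degNumerator : {n : ℕ} → (Vec ℕ n → Vec ℕ n) → List (Vec ℕ n) → ℕ
degNumerator f X = sum (map (λ x → preimageSize f X x * preimageSize f X x) X)

-- In a rooted tree every promotion chain ends at the root, so ∂ maps the labelings Λ into the set Λᵣ
-- of labelings that give the root the label n, and the preimage sizes a(L) = |∂⁻¹(L)| sum to |Λ|
-- over Λᵣ.  Promoting along v, root instead (v the element labelled 1) is another map Λ → Λᵣ, each
-- of whose fibres contains the n labelings obtained by undoing that promotion for the n choices of
-- v; hence n |Λᵣ| ≤ |Λ|.  Summing 2na ≤ a² + n² over Λᵣ and using this bound gives
-- n |Λ| ≤ Σ a² = |Λ| deg(∂), with equality iff a ≡ n on Λᵣ.  For a star these n undone promotions
-- are all the preimages.  Otherwise there is a chain x < z < root, and undoing the promotion along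
-- x, z, root of a natural labeling produces an (n+1)-st preimage.

module Submission where

open import Defs
open import Data.Nat using (ℕ; zero; suc; _+_; _*_; _∸_; _≤_; _<_; z≤n; s≤s; _≡ᵇ_; _≤ᵇ_; _≟_)
open import Data.Nat.Properties
  using (+-identityʳ; +-mono-≤; +-monoʳ-≤; +-mono-<-≤; +-mono-≤-<; +-cancelʳ-≤; +-cancelʳ-<;
         *-zeroʳ; *-suc; *-assoc; *-distribˡ-+; *-monoʳ-≤; *-mono-<; ≤-refl; ≤-reflexive; ≤-trans;
         ≤-antisym; ≤-total; <⇒≤; <⇒≢; <⇒≱; >⇒≢; ≰⇒>; n≤1+n; m∸n≤m; m≤m+n; m<m+n;
         m≤n⇒∃[o]m+o≡n; m≤n⇒m<n∨m≡n; suc-injective; ≡ᵇ⇒≡; ≡⇒≡ᵇ; ≤ᵇ⇒≤; ≤⇒≤ᵇ;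
         +-commutativeSemigroup; module ≤-Reasoning)
open import Algebra.Properties.CommutativeSemigroup +-commutativeSemigroup using () renaming (interchange to +-interchange)
open import Data.List using (List; []; _∷_; length; map; filter; allFin; upTo)
open import Data.List.Properties using (length-map; length-upTo; length-tabulate; filter-notAll; filter-none)
open import Data.List.Membership.Propositional using (_∈_; _∉_)
open import Data.List.Membership.Propositional.Properties
  using (∈-filter⁺; ∈-filter⁻; ∈-allFin; ∈-map⁺; ∈-map⁻; ∈-upTo⁺; ∈-upTo⁻;
         ∈-concatMap⁺; ∈-concatMap⁻)
open import Data.List.Relation.Binary.Subset.Propositional using (_⊆_)
open import Data.List.Relation.Binary.Disjoint.Propositional using (Disjoint)
open import Data.List.Relation.Unary.Any as Any using (here; there)
open import Data.List.Relation.Unary.All as All using (All; []; _∷_)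
open import Data.List.Relation.Unary.AllPairs using (AllPairs; []; _∷_)
open import Data.List.Relation.Unary.Unique.Propositional using (Unique)
import Data.List.Relation.Unary.Unique.Propositional.Properties as Unique
import Data.List.Relation.Unary.AllPairs as AllPairs
import Data.List.Relation.Unary.AllPairs.Properties as AllPairs
open import Data.List.Relation.Unary.All.Properties using (all⁺; all⁻; ¬All⇒Any¬; All¬⇒¬Any)
open import Data.Maybe using (just; nothing)
open import Data.Maybe.Properties using (just-injective)
open import Data.Nat.ListAction using (sum)
open import Data.Vec as Vec using (Vec; lookup; tabulate)
open import Data.Vec.Properties using (≡-dec; lookup∘tabulate; tabulate∘lookup; tabulate-cong; ∷-injectiveˡ; ∷-injectiveʳ)
open import Data.Product using (∃; _×_; _,_; proj₁; proj₂)
open import Data.Sum as Sum using (_⊎_; inj₁; inj₂)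
open import Data.Empty using (⊥-elim)
open import Data.Bool using (true; false; T)
open import Data.Fin as Fin using (Fin)
import Data.Fin.Properties as Fin
open import Data.Fin.Properties using (any?) renaming (_≟_ to _≟ᶠ_)
open import Function using (_∘_)
open import Function.Bundles using (_⇔_; mk⇔)
open import Relation.Nullary using (¬_; Dec; yes; no; contradiction)
open import Relation.Nullary.Decidable using (¬?; T?; _×-dec_; decidable-stable; dec-true)
open import Relation.Binary using (DecidableEquality; tri<; tri≈; tri>)
open import Relation.Unary using (Decidable)
open import Relation.Binary.PropositionalEquality
  using (_≡_; _≢_; refl; sym; trans; cong; cong₂; subst; subst₂; module ≡-Reasoning)
open import Relation.Binary.Structures using (IsDecPartialOrder)
import Relation.Binary.Construct.NonStrictToStrict as NonStrictToStrict
import Induction.WellFounded as WF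
open import Data.Fin.Induction using (po-wellFounded; po-noetherian)
open import Level using (0ℓ)
open import Relation.Binary.Construct.Closure.ReflexiveTransitive using (Star; ε; _◅_)

module _ {A : Set} where

  sum-map-cong : ∀ {f g : A → ℕ} xs → (∀ {x} → x ∈ xs → f x ≡ g x) → sum (map f xs) ≡ sum (map g xs)
  sum-map-cong []       _   = refl
  sum-map-cong (x ∷ xs) f≡g = cong₂ _+_ (f≡g (here refl)) (sum-map-cong xs (f≡g ∘ there))

  sum-map-mono-≤ : ∀ {f g : A → ℕ} xs → (∀ {x} → x ∈ xs → f x ≤ g x) → sum (map f xs) ≤ sum (map g xs)
  sum-map-mono-≤ []       _   = z≤n
  sum-map-mono-≤ (x ∷ xs) f≤g = +-mono-≤ (f≤g (here refl)) (sum-map-mono-≤ xs (f≤g ∘ there))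

  sum-map-mono-< : ∀ {f g : A → ℕ} xs → (∀ {x} → x ∈ xs → f x ≤ g x) →
                   ∀ {y} → y ∈ xs → f y < g y → sum (map f xs) < sum (map g xs)
  sum-map-mono-< (x ∷ xs) f≤g (here refl) fy<gy = +-mono-<-≤ fy<gy (sum-map-mono-≤ xs (f≤g ∘ there))
  sum-map-mono-< (x ∷ xs) f≤g (there y∈xs) fy<gy =
    +-mono-≤-< (f≤g (here refl)) (sum-map-mono-< xs (f≤g ∘ there) y∈xs fy<gy)

  sum-map-+ : ∀ (f g : A → ℕ) xs → sum (map (λ x → f x + g x) xs) ≡ sum (map f xs) + sum (map g xs)
  sum-map-+ f g []       = refl
  sum-map-+ f g (x ∷ xs) =
    trans (cong (f x + g x +_) (sum-map-+ f g xs)) (+-interchange (f x) (g x) _ _)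

  sum-map-*ˡ : ∀ k (f : A → ℕ) xs → sum (map (λ x → k * f x) xs) ≡ k * sum (map f xs)
  sum-map-*ˡ k f []       = sym (*-zeroʳ k)
  sum-map-*ˡ k f (x ∷ xs) = trans (cong (k * f x +_) (sum-map-*ˡ k f xs)) (sym (*-distribˡ-+ k (f x) _))

  sum-map-const : ∀ k (xs : List A) → sum (map (λ _ → k) xs) ≡ k * length xs
  sum-map-const k []       = sym (*-zeroʳ k)
  sum-map-const k (x ∷ xs) = trans (cong (k +_) (sum-map-const k xs)) (sym (*-suc k (length xs)))

  sum-map-filter : ∀ {P : A → Set} (P? : Decidable P) (f : A → ℕ) xs → (∀ {x} → x ∈ xs → ¬ P x → f x ≡ 0) →
                   sum (map f (filter P? xs)) ≡ sum (map f xs)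
  sum-map-filter P? f []       _    = refl
  sum-map-filter P? f (x ∷ xs) f≡0 with P? x
  ... | yes _  = cong (f x +_) (sum-map-filter P? f xs (f≡0 ∘ there))
  ... | no ¬Px = trans (sum-map-filter P? f xs (f≡0 ∘ there)) (cong (_+ sum (map f xs)) (sym (f≡0 (here refl) ¬Px)))

module _ {A : Set} (_≟_ : DecidableEquality A) where

  ⊆⇒length≤ : ∀ {xs ys : List A} → Unique xs → xs ⊆ ys → length xs ≤ length ys
  ⊆⇒length≤ {[]}     _              _     = z≤n
  ⊆⇒length≤ {x ∷ xs} {ys} (x∉xs ∷ !xs) xs⊆ys = begin
    suc (length xs)                         ≤⟨ s≤s (⊆⇒length≤ !xs xs⊆ys-x) ⟩
    suc (length (filter (¬? ∘ (x ≟_)) ys))  ≤⟨ filter-notAll (¬? ∘ (x ≟_)) ys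
                                                (Any.map (λ { refl ¬x≢x → ¬x≢x refl }) (xs⊆ys (here refl))) ⟩
    length ys                               ∎
    where
    open ≤-Reasoning
    xs⊆ys-x : xs ⊆ filter (¬? ∘ (x ≟_)) ys
    xs⊆ys-x y∈xs = ∈-filter⁺ (¬? ∘ (x ≟_)) (xs⊆ys (there y∈xs)) (All.lookup x∉xs y∈xs)

  ⊂⇒length< : ∀ {xs ys : List A} {y} → Unique xs → xs ⊆ ys → y ∈ ys → y ∉ xs → length xs < length ys
  ⊂⇒length< !xs xs⊆ys y∈ys y∉xs =
    ⊆⇒length≤ (All.tabulate (λ x∈xs y≡x → y∉xs (subst (_∈ _) (sym y≡x) x∈xs)) ∷ !xs)
              λ { (here refl) → y∈ys ; (there x∈xs) → xs⊆ys x∈xs }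

  filter-⊂ : ∀ {P Q : A → Set} (P? : Decidable P) (Q? : Decidable Q) {xs c} → Unique xs →
             (∀ {x} → P x → Q x) → c ∈ xs → Q c → ¬ P c → length (filter P? xs) < length (filter Q? xs)
  filter-⊂ P? Q? {xs} !xs P⇒Q c∈xs Qc ¬Pc =
    ⊂⇒length< (Unique.filter⁺ P? !xs)
      (λ x∈ → let x∈xs , Px = ∈-filter⁻ P? {xs = xs} x∈ in ∈-filter⁺ Q? x∈xs (P⇒Q Px))
      (∈-filter⁺ Q? c∈xs Qc) (¬Pc ∘ proj₂ ∘ ∈-filter⁻ P? {xs = xs})

  preimage : {B : Set} → (B → A) → List B → A → List B
  preimage f ys x = filter (λ y → f y ≟ x) ys

  preimage-∉ : ∀ {B : Set} (f : B → A) {ys x} → (∀ {y} → y ∈ ys → f y ≢ x) → preimage f ys x ≡ []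
  preimage-∉ f f≢x = filter-none (λ y → f y ≟ _) (All.tabulate f≢x)

  private
    preimage-∷ : ∀ {B : Set} (f : B → A) y ys x →
                 length (preimage f (y ∷ ys) x) ≡ length (preimage f (y ∷ []) x) + length (preimage f ys x)
    preimage-∷ f y ys x with f y ≟ x
    ... | yes _ = refl
    ... | no  _ = refl

    sum-preimage-∷ : ∀ {B : Set} (f : B → A) y {xs} → Unique xs → f y ∈ xs →
                     sum (map (length ∘ preimage f (y ∷ [])) xs) ≡ 1
    sum-preimage-∷ f y {x ∷ xs} (x∉xs ∷ !xs) fy∈ with f y ≟ x
    ... | yes refl = cong suc (trans (sum-map-cong xs λ {x′} x′∈xs →
                                       cong length (preimage-∉ f {y ∷ []} {x′} λ { (here refl) → All.lookup x∉xs x′∈xs }))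
                                     (sum-map-const 0 xs))
    ... | no fy≢x with fy∈
    ...   | here fy≡x    = contradiction fy≡x fy≢x
    ...   | there fy∈xs = sum-preimage-∷ f y !xs fy∈xs

  sum-preimage : ∀ {B : Set} (f : B → A) {xs} ys → Unique xs → (∀ {y} → y ∈ ys → f y ∈ xs) →
                 sum (map (length ∘ preimage f ys) xs) ≡ length ys
  sum-preimage f {xs} []       _   _    = sum-map-const 0 xs
  sum-preimage f {xs} (y ∷ ys) !xs f∈xs = begin
    sum (map (length ∘ preimage f (y ∷ ys)) xs)
      ≡⟨ sum-map-cong xs (λ {x} _ → preimage-∷ f y ys x) ⟩
    sum (map (λ x → length (preimage f (y ∷ []) x) + length (preimage f ys x)) xs)
      ≡⟨ sum-map-+ (length ∘ preimage f (y ∷ [])) (length ∘ preimage f ys) xs ⟩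
    sum (map (length ∘ preimage f (y ∷ [])) xs) + sum (map (length ∘ preimage f ys) xs)
      ≡⟨ cong₂ _+_ (sum-preimage-∷ f y !xs (f∈xs (here refl))) (sum-preimage f ys !xs (f∈xs ∘ there)) ⟩
    suc (length ys)
      ∎
    where open ≡-Reasoning

private
  open import Data.Nat.Solver using (module +-*-Solver)

  square-gap : ∀ a k → ∃ λ d → k * a + k * a + d * d ≡ a * a + k * k × (a ≢ k → 0 < d)
  square-gap a k with ≤-total a k
  ... | inj₁ a≤k with d , refl ← m≤n⇒∃[o]m+o≡n a≤k = d , identity a d , positive d
    where
    open +-*-Solver
    identity : ∀ a d → (a + d) * a + (a + d) * a + d * d ≡ a * a + (a + d) * (a + d)
    identity = solve 2 (λ a d → (a :+ d) :* a :+ (a :+ d) :* a :+ d :* d := a :* a :+ (a :+ d) :* (a :+ d)) refl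
    positive : ∀ e → a ≢ a + e → 0 < e
    positive zero    a≢a+0 = contradiction (sym (+-identityʳ a)) a≢a+0
    positive (suc _) _     = s≤s z≤n
  ... | inj₂ k≤a with d , refl ← m≤n⇒∃[o]m+o≡n k≤a = d , identity k d , positive d
    where
    open +-*-Solver
    identity : ∀ k d → k * (k + d) + k * (k + d) + d * d ≡ (k + d) * (k + d) + k * k
    identity = solve 2 (λ k d → k :* (k :+ d) :+ k :* (k :+ d) :+ d :* d := (k :+ d) :* (k :+ d) :+ k :* k) refl
    positive : ∀ e → k + e ≢ k → 0 < e
    positive zero    k+0≢k = contradiction (+-identityʳ k) k+0≢k
    positive (suc _) _     = s≤s z≤n

am-gm : ∀ a k → k * a + k * a ≤ a * a + k * k
am-gm a k with d , eq , _ ← square-gap a k = subst (k * a + k * a ≤_) eq (m≤m+n _ (d * d))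

am-gm-strict : ∀ a k → a ≢ k → k * a + k * a < a * a + k * k
am-gm-strict a k a≢k with d , eq , a≢k⇒0<d ← square-gap a k =
  subst (k * a + k * a <_) eq (m<m+n _ (*-mono-< (a≢k⇒0<d a≢k) (a≢k⇒0<d a≢k)))

module _ {A : Set} (f : A → ℕ) (k : ℕ) (xs : List A) where

  private
    Σf Σf² : ℕ
    Σf  = sum (map f xs)
    Σf² = sum (map (λ x → f x * f x) xs)

    sum-double : sum (map (λ x → k * f x + k * f x) xs) ≡ k * Σf + k * Σf
    sum-double = trans (sum-map-+ (λ x → k * f x) (λ x → k * f x) xs)
                       (cong₂ _+_ (sum-map-*ˡ k f xs) (sum-map-*ˡ k f xs))

    sum-square+k² : k * length xs ≤ Σf → sum (map (λ x → f x * f x + k * k) xs) ≤ Σf² + k * Σf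
    sum-square+k² k|xs|≤Σf = begin
      sum (map (λ x → f x * f x + k * k) xs)   ≡⟨ sum-map-+ (λ x → f x * f x) (λ _ → k * k) xs ⟩
      Σf² + sum (map (λ _ → k * k) xs)          ≡⟨ cong (Σf² +_) (trans (sum-map-const (k * k) xs) (*-assoc k k _)) ⟩
      Σf² + k * (k * length xs)                 ≤⟨ +-monoʳ-≤ Σf² (*-monoʳ-≤ k k|xs|≤Σf) ⟩
      Σf² + k * Σf                              ∎
      where open ≤-Reasoning

  sum-squares-≥ : k * length xs ≤ Σf → k * Σf ≤ Σf²
  sum-squares-≥ k|xs|≤Σf = +-cancelʳ-≤ (k * Σf) (k * Σf) Σf² (begin
    k * Σf + k * Σf                          ≡⟨ sum-double ⟨
    sum (map (λ x → k * f x + k * f x) xs)   ≤⟨ sum-map-mono-≤ xs (λ {x} _ → am-gm (f x) k) ⟩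
    sum (map (λ x → f x * f x + k * k) xs)   ≤⟨ sum-square+k² k|xs|≤Σf ⟩
    Σf² + k * Σf                             ∎)
    where open ≤-Reasoning

  sum-squares-> : k * length xs ≤ Σf → ∀ {y} → y ∈ xs → f y ≢ k → k * Σf < Σf²
  sum-squares-> k|xs|≤Σf y∈xs fy≢k = +-cancelʳ-< (k * Σf) (k * Σf) Σf² (begin-strict
    k * Σf + k * Σf                          ≡⟨ sum-double ⟨
    sum (map (λ x → k * f x + k * f x) xs)   <⟨ sum-map-mono-< xs (λ {x} _ → am-gm (f x) k) y∈xs
                                                                  (am-gm-strict _ k fy≢k) ⟩
    sum (map (λ x → f x * f x + k * k) xs)   ≤⟨ sum-square+k² k|xs|≤Σf ⟩
    Σf² + k * Σf                             ∎)
    where open ≤-Reasoning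

  sum-squares-≡ : (∀ {x} → x ∈ xs → f x ≡ k) → Σf² ≡ k * Σf
  sum-squares-≡ f≡k = trans (sum-map-cong xs (λ {x} x∈xs → cong (_* f x) (f≡k x∈xs))) (sum-map-*ˡ k f xs)

private
  1<⇒1≤∸1 : ∀ {a} → 1 < a → 1 ≤ a ∸ 1
  1<⇒1≤∸1 {suc a} (s≤s 1≤a) = 1≤a

  ∸1<n : ∀ {a n} → 1 ≤ a → a ≤ n → a ∸ 1 < n
  ∸1<n {suc a} _ a<n = a<n

  suc-∸1 : ∀ {a} → 1 ≤ a → suc (a ∸ 1) ≡ a
  suc-∸1 {suc a} _ = refl

  ∸1-injective : ∀ {a b} → 1 ≤ a → 1 ≤ b → a ∸ 1 ≡ b ∸ 1 → a ≡ b
  ∸1-injective {suc a} {suc b} _ _ = cong suc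

record IsLabeling {n} (L : Vec ℕ n) : Set where
  field
    positive  : ∀ i → 1 ≤ lookup L i
    bounded   : ∀ i → lookup L i ≤ n
    injective : ∀ {i j} → lookup L i ≡ lookup L j → i ≡ j

  surjective : ∀ {k} → 1 ≤ k → k ≤ n → ∃ λ i → lookup L i ≡ k
  surjective {k} 1≤k k≤n with any? (λ i → lookup L i Data.Nat.≟ k)
  ... | yes found = found
  ... | no ∄      = contradiction (⊆⇒length≤ _≟_ values-unique values⊆) (<⇒≱ too-few)
    where
    labels values : List ℕ
    labels = map suc (upTo n)
    values = map (lookup L) (allFin n)

    values-unique : Unique values
    values-unique = Unique.map⁺ injective (Unique.allFin⁺ n)

    label∈ : ∀ {x} → 1 ≤ x → x ≤ n → x ∈ labels
    label∈ {suc x} _ x<n = ∈-map⁺ suc (∈-upTo⁺ x<n)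

    values⊆ : values ⊆ filter (¬? ∘ (_≟ k)) labels
    values⊆ v∈values with i , _ , refl ← ∈-map⁻ (lookup L) v∈values =
      ∈-filter⁺ (¬? ∘ (_≟ k)) (label∈ (positive i) (bounded i)) (λ Lᵢ≡k → ∄ (i , Lᵢ≡k))

    too-few : length (filter (¬? ∘ (_≟ k)) labels) < length values
    too-few = begin-strict
      length (filter (¬? ∘ (_≟ k)) labels) <⟨ filter-notAll (¬? ∘ (_≟ k)) labels k∉ ⟩
      length labels                                   ≡⟨ trans (length-map suc (upTo n)) (length-upTo n) ⟩
      n                                               ≡⟨ trans (length-map (lookup L) (allFin n)) (length-tabulate _) ⟨
      length values                                   ∎
      where
      open ≤-Reasoning
      k∉ = Any.map (λ { refl k≢k → k≢k refl }) (label∈ 1≤k k≤n)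

  label>1 : ∀ {v i} → lookup L v ≡ 1 → i ≢ v → 1 < lookup L i
  label>1 {v} {i} Lᵥ≡1 i≢v with m≤n⇒m<n∨m≡n (positive i)
  ... | inj₁ 1<Lᵢ = 1<Lᵢ
  ... | inj₂ 1≡Lᵢ = contradiction (injective (trans (sym 1≡Lᵢ) (sym Lᵥ≡1))) i≢v

  label<n : ∀ {v i} → lookup L v ≡ n → i ≢ v → lookup L i < n
  label<n {v} {i} Lᵥ≡n i≢v with m≤n⇒m<n∨m≡n (bounded i)
  ... | inj₁ Lᵢ<n = Lᵢ<n
  ... | inj₂ Lᵢ≡n = contradiction (injective (trans Lᵢ≡n (sym Lᵥ≡n))) i≢v

isLabeling-tabulate : ∀ {n} {f : Fin n → ℕ} → (∀ i → 1 ≤ f i) → (∀ i → f i ≤ n) →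
                      (∀ {i j} → f i ≡ f j → i ≡ j) → IsLabeling (tabulate f)
isLabeling-tabulate {f = f} pos bnd inj = record
  { positive  = λ i → subst (1 ≤_) (sym (lookup∘tabulate f i)) (pos i)
  ; bounded   = λ i → subst (_≤ _) (sym (lookup∘tabulate f i)) (bnd i)
  ; injective = λ {i} {j} eq → inj (trans (sym (lookup∘tabulate f i)) (trans eq (lookup∘tabulate f j)))
  }

module _ (vals : List ℕ) where

  private
    ∷-∈-allVecs⁻ : ∀ {k a} {v : Vec ℕ k} → a Vec.∷ v ∈ allVecs vals (suc k) → a ∈ vals × v ∈ allVecs vals k
    ∷-∈-allVecs⁻ av∈ = Any.map proj₁ found , proj₂ (proj₂ (Any.satisfied found))
      where
      found = Any.map (λ av∈b∷ → let _ , w∈ , av≡bw = ∈-map⁻ _ av∈b∷ in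
                                 ∷-injectiveˡ av≡bw , subst (_∈ _) (sym (∷-injectiveʳ av≡bw)) w∈)
                      (∈-concatMap⁻ _ av∈)

  ∈-allVecs⁺ : ∀ {k} (v : Vec ℕ k) → (∀ i → lookup v i ∈ vals) → v ∈ allVecs vals k
  ∈-allVecs⁺ Vec.[]       _  = here refl
  ∈-allVecs⁺ (a Vec.∷ v) v∈ =
    ∈-concatMap⁺ _ (Any.map (λ { refl → ∈-map⁺ (a Vec.∷_) (∈-allVecs⁺ v (v∈ ∘ Fin.suc)) }) (v∈ Fin.zero))

  ∈-allVecs⁻ : ∀ {k} (v : Vec ℕ k) → v ∈ allVecs vals k → ∀ i → lookup v i ∈ vals
  ∈-allVecs⁻ (a Vec.∷ v) av∈ Fin.zero    = proj₁ (∷-∈-allVecs⁻ av∈)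
  ∈-allVecs⁻ (a Vec.∷ v) av∈ (Fin.suc i) = ∈-allVecs⁻ v (proj₂ (∷-∈-allVecs⁻ av∈)) i

  allVecs-unique : Unique vals → ∀ k → Unique (allVecs vals k)
  allVecs-unique _     zero    = [] ∷ []
  allVecs-unique !vals (suc k) =
    Unique.concat⁺ (All.tabulate λ xs∈ → subst Unique (sym (proj₂ (proj₂ (∈-map⁻ _ xs∈))))
                                                (Unique.map⁺ ∷-injectiveʳ (allVecs-unique !vals k)))
                   (AllPairs.map⁺ (AllPairs.map disjoint !vals))
    where
    disjoint : ∀ {a b} → a ≢ b → Disjoint (map (a Vec.∷_) (allVecs vals k)) (map (b Vec.∷_) (allVecs vals k))
    disjoint a≢b (av∈ , bw∈) with _ , _ , refl ← ∈-map⁻ _ av∈ | _ , _ , eq ← ∈-map⁻ _ bw∈ =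
      a≢b (∷-injectiveˡ eq)

module _ {n : ℕ} {L : Vec ℕ n} where

  private
    isLabelingᵇ-sound : T (isLabelingᵇ L) → ∀ {i j} → lookup L i ≡ lookup L j → i ≡ j
    isLabelingᵇ-sound t {i} {j} Lᵢ≡Lⱼ
      with All.lookup (all⁺ _ _ (All.lookup (all⁺ _ _ t) (∈-allFin i))) (∈-allFin j)
    ... | tᵢⱼ with i ≟ᶠ j | lookup L i ≡ᵇ lookup L j in eq
    ...   | yes i≡j | _     = i≡j
    ...   | no _    | true  = ⊥-elim tᵢⱼ
    ...   | no _    | false = ⊥-elim (subst T eq (≡⇒≡ᵇ _ _ Lᵢ≡Lⱼ))

    isLabelingᵇ-complete : (∀ {i j} → lookup L i ≡ lookup L j → i ≡ j) → T (isLabelingᵇ L)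
    isLabelingᵇ-complete inj = decidable-stable (T? _) refute
      where
      refute : ¬ ¬ T (isLabelingᵇ L)
      refute ¬t with Any.satisfied (¬All⇒Any¬ (λ _ → T? _) (allFin n) (λ ts → ¬t (all⁻ _ ts)))
      ... | i , ¬tᵢ with Any.satisfied (¬All⇒Any¬ (λ _ → T? _) (allFin n) (λ ts → ¬tᵢ (all⁻ _ ts)))
      ...   | j , ¬tᵢⱼ with i ≟ᶠ j | lookup L i ≡ᵇ lookup L j in eq
      ...     | yes _   | true  = ¬tᵢⱼ _
      ...     | yes _   | false = ¬tᵢⱼ _
      ...     | no _    | false = ¬tᵢⱼ _
      ...     | no i≢j  | true  = i≢j (inj (≡ᵇ⇒≡ _ _ (subst T (sym eq) _)))

    label∈ : ∀ {x} → 1 ≤ x → x ≤ n → x ∈ map suc (upTo n)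
    label∈ {suc x} _ x<n = ∈-map⁺ suc (∈-upTo⁺ x<n)

  ∈-Λ⁺ : IsLabeling L → L ∈ Λ n
  ∈-Λ⁺ isLab = ∈-filter⁺ (λ L → T? (isLabelingᵇ L))
    (∈-allVecs⁺ _ L (λ i → label∈ (positive i) (bounded i))) (isLabelingᵇ-complete injective)
    where open IsLabeling isLab

  ∈-Λ⁻ : L ∈ Λ n → IsLabeling L
  ∈-Λ⁻ L∈Λ with L∈vecs , t ← ∈-filter⁻ (λ L → T? (isLabelingᵇ L)) L∈Λ = record
    { positive  = λ i → proj₁ (bounds i)
    ; bounded   = λ i → proj₂ (bounds i)
    ; injective = isLabelingᵇ-sound t
    }
    where
    bounds : ∀ i → 1 ≤ lookup L i × lookup L i ≤ n
    bounds i with _ , y∈ , eq ← ∈-map⁻ suc (∈-allVecs⁻ _ L L∈vecs i) =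
      subst (λ x → 1 ≤ x × x ≤ n) (sym eq) (s≤s z≤n , ∈-upTo⁻ y∈)

Λ-unique : ∀ n → Unique (Λ n)
Λ-unique n = Unique.filter⁺ _ (allVecs-unique _ (Unique.map⁺ suc-injective (Unique.upTo⁺ n)) n)

module Order {n} (P : FinPoset n) where

  open FinPoset P
  open IsDecPartialOrder isDecPartialOrder using (isPartialOrder; antisym) renaming (refl to ≼-refl; trans to ≼-trans)
  private module Strict = NonStrictToStrict {A = Fin n} _≡_ _≼_

  ≺-irrefl : ∀ {x} → ¬ x ≺ x
  ≺-irrefl (_ , x≢x) = x≢x refl

  ≺-trans : ∀ {x y z} → x ≺ y → y ≺ z → x ≺ z
  ≺-trans = Strict.<-trans isPartialOrder

  ≺-asym : ∀ {x y} → x ≺ y → ¬ y ≺ x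
  ≺-asym = Strict.<-asym antisym

  ≼-≺-trans : ∀ {x y z} → x ≼ y → y ≺ z → x ≺ z
  ≼-≺-trans x≼y (y≼z , y≢z) = ≼-trans x≼y y≼z , λ { refl → y≢z (antisym y≼z x≼y) }

  _≺?_ : ∀ x y → Dec (x ≺ y)
  _≺?_ = Strict.<-decidable _≟ᶠ_ _≤?_

  ∈-above⁺ : ∀ {v w} → v ≺ w → w ∈ above v
  ∈-above⁺ {v} {w} v≺w = ∈-filter⁺ (λ y → T? (ltᵇ v y)) (∈-allFin w) (subst T (sym (dec-true (v ≺? w) v≺w)) _)

  ∈-above⁻ : ∀ {v w} → w ∈ above v → v ≺ w
  ∈-above⁻ {v} {w} w∈ with v ≤? w | v ≟ᶠ w | proj₂ (∈-filter⁻ (λ y → T? (ltᵇ v y)) {xs = allFin n} w∈)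
  ... | yes v≼w | no v≢w | _ = v≼w , v≢w

  module ≺-Rec = WF.All (po-wellFounded isPartialOrder) 0ℓ
  module ≻-Rec = WF.All (po-noetherian isPartialOrder) 0ℓ

  maximal-above : ∀ v → ∃ λ M → v ≼ M × Maximal M
  maximal-above = ≻-Rec.wfRec _ step
    where
    step : ∀ v → (∀ {w} → v ≺ w → ∃ λ M → w ≼ M × Maximal M) → ∃ λ M → v ≼ M × Maximal M
    step v ih with any? (v ≺?_)
    ... | yes (w , v≺w) = let M , w≼M , M-max = ih v≺w in M , ≼-trans (proj₁ v≺w) w≼M , M-max
    ... | no ∄          = v , ≼-refl , λ w v≺w → ∄ (w , v≺w)

  minimal-below : ∀ v → ∃ λ M → M ≼ v × Minimal M
  minimal-below = ≺-Rec.wfRec _ step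
    where
    step : ∀ v → (∀ {w} → w ≺ v → ∃ λ M → M ≼ w × Minimal M) → ∃ λ M → M ≼ v × Minimal M
    step v ih with any? (_≺? v)
    ... | yes (w , w≺v) = let M , M≼w , M-min = ih w≺v in M , ≼-trans M≼w (proj₁ w≺v) , M-min
    ... | no ∄          = v , ≼-refl , λ w w≺v → ∄ (w , w≺v)

  cover-below : ∀ {x y} → x ≺ y → ∃ λ c → x ⋖ c × c ≼ y
  cover-below {x} = ≺-Rec.wfRec (λ y → x ≺ y → ∃ λ c → x ⋖ c × c ≼ y) step _
    where
    step : ∀ y → (∀ {z} → z ≺ y → x ≺ z → ∃ λ c → x ⋖ c × c ≼ z) → x ≺ y → ∃ λ c → x ⋖ c × c ≼ y
    step y ih x≺y with any? (λ z → (x ≺? z) ×-dec (z ≺? y))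
    ... | yes (z , x≺z , z≺y) = let c , x⋖c , c≼z = ih z≺y x≺z in c , x⋖c , ≼-trans c≼z (proj₁ z≺y)
    ... | no ∄                = y , (x≺y , λ z x≺z≺y → ∄ (z , x≺z≺y)) , ≼-refl

module RootedTree {m} (P : FinPoset (suc m)) (tree : FinPoset.IsRootedTree P) where

  open FinPoset P
  open IsDecPartialOrder isDecPartialOrder using () renaming (trans to ≼-trans)
  open Order P

  maximal-unique : ∀ {a M₁ M₂} → a ≼ M₁ → a ≼ M₂ → Maximal M₁ → Maximal M₂ → M₁ ≡ M₂
  maximal-unique {a} {M₁} {M₂} a≼M₁ a≼M₂ M₁-max M₂-max =
    ≻-Rec.wfRec (λ a → a ≼ M₁ → a ≼ M₂ → M₁ ≡ M₂) step a a≼M₁ a≼M₂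
    where
    step : ∀ a → (∀ {c} → a ≺ c → c ≼ M₁ → c ≼ M₂ → M₁ ≡ M₂) → a ≼ M₁ → a ≼ M₂ → M₁ ≡ M₂
    step a ih a≼M₁ a≼M₂ with a ≟ᶠ M₁ | a ≟ᶠ M₂
    ... | yes refl | yes refl = refl
    ... | yes refl | no a≢M₂  = contradiction (a≼M₂ , a≢M₂) (M₁-max M₂)
    ... | no a≢M₁  | yes refl = contradiction (a≼M₁ , a≢M₁) (M₂-max M₁)
    ... | no a≢M₁  | no a≢M₂
      with c₁ , a⋖c₁ , c₁≼M₁ ← cover-below (a≼M₁ , a≢M₁) | c₂ , a⋖c₂ , c₂≼M₂ ← cover-below (a≼M₂ , a≢M₂)
      rewrite proj₂ tree a c₁ c₂ a⋖c₁ a⋖c₂ = ih (proj₁ a⋖c₂) c₁≼M₁ c₂≼M₂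

  top : Fin (suc m) → Fin (suc m)
  top v = proj₁ (maximal-above v)

  private
    ≼-top : ∀ v → v ≼ top v
    ≼-top v = proj₁ (proj₂ (maximal-above v))

    top-maximal : ∀ v → Maximal (top v)
    top-maximal v = proj₂ (proj₂ (maximal-above v))

    top-≼ : ∀ {a b} → a ≼ b → top a ≡ top b
    top-≼ {a} {b} a≼b = maximal-unique (≼-top a) (≼-trans a≼b (≼-top b)) (top-maximal a) (top-maximal b)

    top-connected : ∀ {a b} → Star Comparable a b → top a ≡ top b
    top-connected ε                  = refl
    top-connected (inj₁ a≼c ◅ c⋯b) = trans (top-≼ a≼c) (top-connected c⋯b)
    top-connected (inj₂ c≼a ◅ c⋯b) = trans (sym (top-≼ c≼a)) (top-connected c⋯b)

  root : Fin (suc m)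
  root = top Fin.zero

  root-maximal : Maximal root
  root-maximal = top-maximal Fin.zero

  ≼-root : ∀ v → v ≼ root
  ≼-root v = subst (v ≼_) (top-connected (proj₁ tree v Fin.zero)) (≼-top v)

  ≺-root : ∀ {v} → v ≢ root → v ≺ root
  ≺-root v≢root = ≼-root _ , v≢root

  maximal⇒≡root : ∀ {v} → Maximal v → v ≡ root
  maximal⇒≡root {v} v-max with v ≟ᶠ root
  ... | yes v≡root = v≡root
  ... | no v≢root  = contradiction (≺-root v≢root) (v-max root)

  Flat : Set
  Flat = ∀ {u w} → u ≺ w → w ≡ root

  flat⇒star : Flat → IsRootedStar
  flat⇒star flat = tree , root , root-maximal ,
    λ x _ x≢root → ≺-root x≢root , λ z (x≺z , z≺root) → proj₂ z≺root (flat x≺z)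

  star⇒flat : IsRootedStar → Flat
  star⇒flat (_ , r , r-max , covers) {u} {w} u≺w with w ≟ᶠ root
  ... | yes w≡root = w≡root
  ... | no w≢root with M , M≼u , M-min ← minimal-below u =
    contradiction (M≺w , w≺r) (proj₂ (covers M M-min M≢r) w)
    where
    M≺w : M ≺ w
    M≺w = ≼-≺-trans M≼u u≺w
    w≺r : w ≺ r
    w≺r = subst (w ≺_) (sym (maximal⇒≡root r-max)) (≺-root w≢root)
    M≢r : M ≢ r
    M≢r refl = ≺-asym M≺w w≺r

module Chain {n} (P : FinPoset n) where

  open FinPoset P
  open import Data.List.Membership.DecPropositional (_≟ᶠ_ {n}) using (_∈?_)

  last : Fin n → List (Fin n) → Fin n
  last v []      = v
  last _ (w ∷ t) = last w t

  next : List (Fin n) → Fin n → Fin n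
  next c x with succIn c x
  ... | just (just y) = y
  ... | _             = x

  prev : Fin n → List (Fin n) → Fin n → Fin n
  prev v []      y = y
  prev v (w ∷ t) y with w ≟ᶠ y
  ... | yes _ = v
  ... | no  _ = prev w t y

  -- Promotion of L along the chain c, exactly as the local function `new` in the definition of ∂.
  promotedLabel : Vec ℕ n → List (Fin n) → Fin n → ℕ
  promotedLabel L c x with succIn c x
  ... | nothing       = lookup L x ∸ 1
  ... | just nothing  = n
  ... | just (just y) = lookup L y ∸ 1

  promoteAlong : Vec ℕ n → List (Fin n) → Vec ℕ n
  promoteAlong L c = tabulate (promotedLabel L c)

  demotedLabel : Vec ℕ n → Fin n → List (Fin n) → Fin n → ℕ
  demotedLabel L v t i with i ≟ᶠ v
  ... | yes _ = 1
  ... | no  _ = suc (lookup L (prev v t i))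

  demoteAlong : Vec ℕ n → Fin n → List (Fin n) → Vec ℕ n
  demoteAlong L v t = tabulate (demotedLabel L v t)

  last-∈ : ∀ v t → last v t ∈ v ∷ t
  last-∈ v []      = here refl
  last-∈ _ (w ∷ t) = there (last-∈ w t)

  succIn-∉ : ∀ {v t x} → x ∉ v ∷ t → succIn (v ∷ t) x ≡ nothing
  succIn-∉ {v} {[]}    {x} x∉ with v ≟ᶠ x
  ... | yes refl = contradiction (here refl) x∉
  ... | no  _    = refl
  succIn-∉ {v} {w ∷ t} {x} x∉ with v ≟ᶠ x
  ... | yes refl = contradiction (here refl) x∉
  ... | no  _    = succIn-∉ {w} {t} (x∉ ∘ there)

  succIn≡nothing⇒∉ : ∀ {v t x} → succIn (v ∷ t) x ≡ nothing → x ∉ v ∷ t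
  succIn≡nothing⇒∉ {v} {[]} {x} eq x∈ with v ≟ᶠ x
  succIn≡nothing⇒∉ {v} {[]} {x} () x∈          | yes _
  succIn≡nothing⇒∉ {v} {[]} {x} eq (here refl) | no v≢x = v≢x refl
  succIn≡nothing⇒∉ {v} {w ∷ t} {x} eq x∈ with v ≟ᶠ x
  succIn≡nothing⇒∉ {v} {w ∷ t} {x} () x∈          | yes _
  succIn≡nothing⇒∉ {v} {w ∷ t} {x} eq (here refl) | no v≢x = v≢x refl
  succIn≡nothing⇒∉ {v} {w ∷ t} {x} eq (there x∈) | no _   = succIn≡nothing⇒∉ {w} {t} eq x∈

  succIn-last : ∀ {v t} → Unique (v ∷ t) → succIn (v ∷ t) (last v t) ≡ just nothing
  succIn-last {v} {[]}    _ with v ≟ᶠ v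
  ... | yes _   = refl
  ... | no v≢v = contradiction refl v≢v
  succIn-last {v} {w ∷ t} (v∉ ∷ !wt) with v ≟ᶠ last w t
  ... | yes v≡last = contradiction (subst (_∈ _) (sym v≡last) (last-∈ w t)) (All¬⇒¬Any v∉)
  ... | no  _      = succIn-last {w} {t} !wt

  succIn≡just-nothing⇒last : ∀ {v t x} → succIn (v ∷ t) x ≡ just nothing → x ≡ last v t
  succIn≡just-nothing⇒last {v} {[]} {x} eq with v ≟ᶠ x
  ... | yes v≡x = sym v≡x
  succIn≡just-nothing⇒last {v} {[]} {x} () | no _
  succIn≡just-nothing⇒last {v} {w ∷ t} {x} eq with v ≟ᶠ x
  succIn≡just-nothing⇒last {v} {w ∷ t} {x} () | yes _
  ... | no _ = succIn≡just-nothing⇒last {w} {t} eq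

  succIn≡just⇒∈ : ∀ {v t x y} → succIn (v ∷ t) x ≡ just (just y) → y ∈ t
  succIn≡just⇒∈ {v} {[]} {x} eq with v ≟ᶠ x
  succIn≡just⇒∈ {v} {[]} {x} () | yes _
  succIn≡just⇒∈ {v} {[]} {x} () | no _
  succIn≡just⇒∈ {v} {w ∷ t} {x} eq with v ≟ᶠ x
  succIn≡just⇒∈ {v} {w ∷ t} {x} refl | yes _ = here refl
  ... | no _ = there (succIn≡just⇒∈ {w} {t} eq)

  prev-∉ : ∀ {v t y} → y ∉ t → prev v t y ≡ y
  prev-∉ {v} {[]}    _  = refl
  prev-∉ {v} {w ∷ t} {y} y∉ with w ≟ᶠ y
  ... | yes refl = contradiction (here refl) y∉
  ... | no  _    = prev-∉ {w} {t} (y∉ ∘ there)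

  prev-here : ∀ v w t → prev v (w ∷ t) w ≡ v
  prev-here v w t with w ≟ᶠ w
  ... | yes _   = refl
  ... | no w≢w = contradiction refl w≢w

  prev-there : ∀ {v w t y} → w ≢ y → prev v (w ∷ t) y ≡ prev w t y
  prev-there {w = w} {y = y} w≢y with w ≟ᶠ y
  ... | yes w≡y = contradiction w≡y w≢y
  ... | no  _   = refl

  prev-succIn : ∀ {v t x y} → Unique (v ∷ t) → succIn (v ∷ t) x ≡ just (just y) → prev v t y ≡ x
  prev-succIn {v} {[]} {x} _ eq with v ≟ᶠ x
  prev-succIn {v} {[]} {x} _ () | yes _
  prev-succIn {v} {[]} {x} _ () | no _
  prev-succIn {v} {w ∷ t} {x} _ eq with v ≟ᶠ x
  prev-succIn {v} {w ∷ t} {x} _ refl | yes refl = prev-here v w t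
  prev-succIn {v} {w ∷ t} {x} {y} (_ ∷ !wt@(w∉ ∷ _)) eq | no _ with w ≟ᶠ y
  ... | yes refl = contradiction (succIn≡just⇒∈ {w} {t} eq) (All¬⇒¬Any w∉)
  ... | no  _    = prev-succIn {w} {t} !wt eq

  succIn-prev : ∀ {v t y} → Unique (v ∷ t) → y ∈ t → succIn (v ∷ t) (prev v t y) ≡ just (just y)
  succIn-prev {v} {w ∷ t} {y} (v∉ ∷ !wt) y∈ with w ≟ᶠ y
  ... | yes refl with v ≟ᶠ v
  ...   | yes _   = refl
  ...   | no v≢v = contradiction refl v≢v
  succIn-prev {v} {w ∷ t} {y} (v∉ ∷ !wt) (here y≡w)  | no w≢y = contradiction (sym y≡w) w≢y
  succIn-prev {v} {w ∷ t} {y} (v∉ ∷ !wt) (there y∈t) | no w≢y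
    with v ≟ᶠ prev w t y | succIn-prev {w} {t} !wt y∈t
  ... | no  _    | eq = eq
  ... | yes refl | eq = contradiction (trans (sym (succIn-∉ (All¬⇒¬Any v∉))) eq) λ ()

  lookup-demoteAlong-head : ∀ L v t → lookup (demoteAlong L v t) v ≡ 1
  lookup-demoteAlong-head L v t rewrite lookup∘tabulate (demotedLabel L v t) v with v ≟ᶠ v
  ... | yes _   = refl
  ... | no v≢v = contradiction refl v≢v

  lookup-demoteAlong : ∀ L {v t i} → i ≢ v → lookup (demoteAlong L v t) i ≡ suc (lookup L (prev v t i))
  lookup-demoteAlong L {v} {t} {i} i≢v rewrite lookup∘tabulate (demotedLabel L v t) i with i ≟ᶠ v
  ... | yes i≡v = contradiction i≡v i≢v
  ... | no  _   = refl

  lookup-demoteAlong-∉ : ∀ L {v t i} → i ∉ v ∷ t → lookup (demoteAlong L v t) i ≡ suc (lookup L i)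
  lookup-demoteAlong-∉ L {v} i∉ =
    trans (lookup-demoteAlong L (i∉ ∘ here)) (cong (suc ∘ lookup L) (prev-∉ {v} (i∉ ∘ there)))

  next-∉ : ∀ {v t x} → x ∉ v ∷ t → next (v ∷ t) x ≡ x
  next-∉ x∉ rewrite succIn-∉ x∉ = refl

  next-succIn : ∀ {c x y} → succIn c x ≡ just (just y) → next c x ≡ y
  next-succIn eq rewrite eq = refl

  module _ {v : Fin n} {t : List (Fin n)} (!vt : Unique (v ∷ t)) where

    private
      v∉t : v ∉ t
      v∉t = All¬⇒¬Any (AllPairs.head !vt)

    prev-next : ∀ {x} → x ≢ last v t → prev v t (next (v ∷ t) x) ≡ x
    prev-next {x} x≢last with succIn (v ∷ t) x in eq
    ... | nothing       = prev-∉ {v} (succIn≡nothing⇒∉ {v} {t} eq ∘ there)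
    ... | just nothing  = contradiction (succIn≡just-nothing⇒last {v} {t} eq) x≢last
    ... | just (just y) = prev-succIn !vt eq

    next-prev : ∀ {y} → y ≢ v → next (v ∷ t) (prev v t y) ≡ y
    next-prev {y} y≢v with y ∈? t
    ... | yes y∈t = next-succIn {v ∷ t} (succIn-prev !vt y∈t)
    ... | no  y∉t = trans (cong (next (v ∷ t)) (prev-∉ {v} y∉t))
                          (next-∉ λ { (here y≡v) → y≢v y≡v ; (there y∈t) → y∉t y∈t })

    next≢head : ∀ {x} → x ≢ last v t → next (v ∷ t) x ≢ v
    next≢head {x} x≢last with succIn (v ∷ t) x in eq
    ... | nothing       = λ x≡v → succIn≡nothing⇒∉ {v} {t} eq (here x≡v)
    ... | just nothing  = contradiction (succIn≡just-nothing⇒last {v} {t} eq) x≢last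
    ... | just (just y) = λ y≡v → v∉t (subst (_∈ t) y≡v (succIn≡just⇒∈ {v} {t} eq))

    prev≢last : ∀ {y} → y ≢ v → prev v t y ≢ last v t
    prev≢last {y} y≢v with y ∈? t
    ... | yes y∈t = λ p≡last →
      contradiction (trans (sym (succIn-prev !vt y∈t)) (trans (cong (succIn (v ∷ t)) p≡last) (succIn-last !vt))) λ ()
    ... | no  y∉t = λ p≡last → y∉vt (subst (_∈ v ∷ t) (trans (sym p≡last) (prev-∉ {v} y∉t)) (last-∈ v t))
      where
      y∉vt : y ∉ v ∷ t
      y∉vt (here y≡v)  = y≢v y≡v
      y∉vt (there y∈t) = y∉t y∈t

    promotedLabel-last : ∀ L → promotedLabel L (v ∷ t) (last v t) ≡ n
    promotedLabel-last L rewrite succIn-last !vt = refl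

    promotedLabel-next : ∀ L {x} → x ≢ last v t → promotedLabel L (v ∷ t) x ≡ lookup L (next (v ∷ t) x) ∸ 1
    promotedLabel-next L {x} x≢last with succIn (v ∷ t) x in eq
    ... | nothing       = refl
    ... | just nothing  = contradiction (succIn≡just-nothing⇒last {v} {t} eq) x≢last
    ... | just (just y) = refl

    lookup-promoteAlong-last : ∀ L → lookup (promoteAlong L (v ∷ t)) (last v t) ≡ n
    lookup-promoteAlong-last L = trans (lookup∘tabulate _ (last v t)) (promotedLabel-last L)

    promoteAlong-isLabeling : ∀ {L} → IsLabeling L → lookup L v ≡ 1 → IsLabeling (promoteAlong L (v ∷ t))
    promoteAlong-isLabeling {L} isLab Lᵥ≡1 = isLabeling-tabulate positive′ bounded′ injective′
      where
      open IsLabeling isLab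
      n>0 : 1 ≤ n
      n>0 = ≤-trans (positive v) (bounded v)
      positive′ : ∀ x → 1 ≤ promotedLabel L (v ∷ t) x
      positive′ x with x ≟ᶠ last v t
      ... | yes refl    = subst (1 ≤_) (sym (promotedLabel-last L)) n>0
      ... | no  x≢last = subst (1 ≤_) (sym (promotedLabel-next L x≢last))
                                  (1<⇒1≤∸1 (label>1 Lᵥ≡1 (next≢head x≢last)))
      bounded′ : ∀ x → promotedLabel L (v ∷ t) x ≤ n
      bounded′ x with x ≟ᶠ last v t
      ... | yes refl    = ≤-reflexive (promotedLabel-last L)
      ... | no  x≢last = subst (_≤ n) (sym (promotedLabel-next L x≢last)) (≤-trans (m∸n≤m _ 1) (bounded _))
      below-n : ∀ {x} → x ≢ last v t → promotedLabel L (v ∷ t) x < n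
      below-n {x} x≢last = subst (_< n) (sym (promotedLabel-next L x≢last)) (∸1<n (positive _) (bounded _))
      injective′ : ∀ {x x′} → promotedLabel L (v ∷ t) x ≡ promotedLabel L (v ∷ t) x′ → x ≡ x′
      injective′ {x} {x′} eq with x ≟ᶠ last v t | x′ ≟ᶠ last v t
      ... | yes x≡last | yes x′≡last = trans x≡last (sym x′≡last)
      ... | yes refl   | no x′≢last  = contradiction (trans (sym (promotedLabel-last L)) eq) (<⇒≢ (below-n x′≢last) ∘ sym)
      ... | no x≢last  | yes refl    = contradiction (trans eq (promotedLabel-last L)) (<⇒≢ (below-n x≢last))
      ... | no x≢last  | no x′≢last  = begin
        x                                  ≡⟨ prev-next x≢last ⟨
        prev v t (next (v ∷ t) x)          ≡⟨ cong (prev v t) (injective (∸1-injective (positive _) (positive _) labels≡)) ⟩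
        prev v t (next (v ∷ t) x′)         ≡⟨ prev-next x′≢last ⟩
        x′                                 ∎
        where
        open ≡-Reasoning
        labels≡ = trans (sym (promotedLabel-next L x≢last)) (trans eq (promotedLabel-next L x′≢last))

    demoteAlong-isLabeling : ∀ {L} → IsLabeling L → lookup L (last v t) ≡ n → IsLabeling (demoteAlong L v t)
    demoteAlong-isLabeling {L} isLab L-last≡n = isLabeling-tabulate positive′ bounded′ injective′
      where
      open IsLabeling isLab
      positive′ : ∀ i → 1 ≤ demotedLabel L v t i
      positive′ i with i ≟ᶠ v
      ... | yes _ = s≤s z≤n
      ... | no  _ = s≤s z≤n
      bounded′ : ∀ i → demotedLabel L v t i ≤ n
      bounded′ i with i ≟ᶠ v
      ... | yes _   = ≤-trans (positive v) (bounded v)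
      ... | no  i≢v = label<n L-last≡n (prev≢last i≢v)
      injective′ : ∀ {i j} → demotedLabel L v t i ≡ demotedLabel L v t j → i ≡ j
      injective′ {i} {j} eq with i ≟ᶠ v | j ≟ᶠ v
      ... | yes i≡v | yes j≡v = trans i≡v (sym j≡v)
      ... | yes _   | no  _   = contradiction eq       (<⇒≢ (s≤s (positive _)))
      ... | no  _   | yes _   = contradiction (sym eq) (<⇒≢ (s≤s (positive _)))
      ... | no  i≢v | no  j≢v = begin
        i                        ≡⟨ next-prev i≢v ⟨
        next (v ∷ t) (prev v t i) ≡⟨ cong (next (v ∷ t)) (injective (suc-injective eq)) ⟩
        next (v ∷ t) (prev v t j) ≡⟨ next-prev j≢v ⟩
        j                        ∎
        where open ≡-Reasoning

    promoteAlong-demoteAlong : ∀ {L} → lookup L (last v t) ≡ n → promoteAlong (demoteAlong L v t) (v ∷ t) ≡ L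
    promoteAlong-demoteAlong {L} L-last≡n = trans (tabulate-cong promoted≗L) (tabulate∘lookup L)
      where
      promoted≗L : ∀ x → promotedLabel (demoteAlong L v t) (v ∷ t) x ≡ lookup L x
      promoted≗L x with x ≟ᶠ last v t
      ... | yes refl    = trans (promotedLabel-last _) (sym L-last≡n)
      ... | no  x≢last = begin
        promotedLabel (demoteAlong L v t) (v ∷ t) x            ≡⟨ promotedLabel-next _ x≢last ⟩
        lookup (demoteAlong L v t) (next (v ∷ t) x) ∸ 1        ≡⟨ cong (_∸ 1) (lookup-demoteAlong L (next≢head x≢last)) ⟩
        lookup L (prev v t (next (v ∷ t) x))                   ≡⟨ cong (lookup L) (prev-next x≢last) ⟩
        lookup L x                                             ∎
        where open ≡-Reasoning

    demoteAlong-promoteAlong : ∀ {L} → IsLabeling L → lookup L v ≡ 1 → demoteAlong (promoteAlong L (v ∷ t)) v t ≡ L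
    demoteAlong-promoteAlong {L} isLab Lᵥ≡1 = trans (tabulate-cong demoted≗L) (tabulate∘lookup L)
      where
      demoted≗L : ∀ i → demotedLabel (promoteAlong L (v ∷ t)) v t i ≡ lookup L i
      demoted≗L i with i ≟ᶠ v
      ... | yes refl = sym Lᵥ≡1
      ... | no  i≢v  = begin
        suc (lookup (promoteAlong L (v ∷ t)) (prev v t i))      ≡⟨ cong suc (lookup∘tabulate (promotedLabel L (v ∷ t)) (prev v t i)) ⟩
        suc (promotedLabel L (v ∷ t) (prev v t i))              ≡⟨ cong suc (promotedLabel-next L (prev≢last i≢v)) ⟩
        suc (lookup L (next (v ∷ t) (prev v t i)) ∸ 1)          ≡⟨ cong (λ y → suc (lookup L y ∸ 1)) (next-prev i≢v) ⟩
        suc (lookup L i ∸ 1)                                    ≡⟨ suc-∸1 (IsLabeling.positive isLab i) ⟩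
        lookup L i                                              ∎
        where open ≡-Reasoning

module Promotion {n} (P : FinPoset n) where

  open FinPoset P
  open Order P
  open Chain P

  minByLabel-≢nothing : ∀ {L xs y} → y ∈ xs → minByLabel L xs ≢ nothing
  minByLabel-≢nothing {L} {x ∷ xs} _ with minByLabel L xs
  ... | nothing = λ ()
  ... | just y with lookup L x ≤ᵇ lookup L y
  ...   | true  = λ ()
  ...   | false = λ ()

  minByLabel-∈ : ∀ {L} xs {w} → minByLabel L xs ≡ just w → w ∈ xs
  minByLabel-∈ {L} (x ∷ xs) eq with minByLabel L xs in e
  ... | nothing = here (sym (just-injective eq))
  ... | just y with lookup L x ≤ᵇ lookup L y
  ...   | true  = here (sym (just-injective eq))
  ...   | false = there (minByLabel-∈ xs (trans e eq))

  minByLabel-minimal : ∀ {L} xs {w} → minByLabel L xs ≡ just w → ∀ {y} → y ∈ xs → lookup L w ≤ lookup L y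
  minByLabel-minimal {L} (x ∷ xs) eq y∈ with minByLabel L xs in e
  ... | nothing with refl ← just-injective eq with y∈
  ...   | here refl  = ≤-refl
  ...   | there y∈xs = contradiction e (minByLabel-≢nothing y∈xs)
  minByLabel-minimal {L} (x ∷ xs) eq y∈ | just z with lookup L x ≤ᵇ lookup L z in x≤ᵇz
  ... | true with refl ← just-injective eq with y∈
  ...   | here refl  = ≤-refl
  ...   | there y∈xs = ≤-trans (≤ᵇ⇒≤ _ _ (subst T (sym x≤ᵇz) _)) (minByLabel-minimal xs e y∈xs)
  minByLabel-minimal {L} (x ∷ xs) eq y∈ | just z | false with refl ← just-injective eq with y∈
  ...   | here refl  = <⇒≤ (≰⇒> (λ x≤z → subst T x≤ᵇz (≤⇒≤ᵇ x≤z)))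
  ...   | there y∈xs = minByLabel-minimal xs e y∈xs

  minByLabel-argmin : ∀ {L xs w} → w ∈ xs → (∀ {y} → y ∈ xs → y ≢ w → lookup L w < lookup L y) →
                      minByLabel L xs ≡ just w
  minByLabel-argmin {L} {xs} {w} w∈ w-min with minByLabel L xs in e
  ... | nothing = contradiction e (minByLabel-≢nothing w∈)
  ... | just w′ with w′ ≟ᶠ w
  ...   | yes refl  = refl
  ...   | no  w′≢w = contradiction (minByLabel-minimal xs e w∈) (<⇒≱ (w-min (minByLabel-∈ xs e) w′≢w))

  mutual
    ∂≡promoteAlong : ∀ {L v} → findLabel1 L (allFin n) ≡ just v → ∂ L ≡ promoteAlong L (chainFrom n L v)
    ∂≡promoteAlong {L} {v} found with findLabel1 L (allFin n) | found
    ... | just .v | refl = tabulate-cong (∂-label≗promotedLabel L v)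

    -- The left-hand side is the local function `new` of ∂, which has no name here; its
    -- meta is solved from the use above.
    private
      ∂-label≗promotedLabel : ∀ L v x → _ ≡ promotedLabel L (chainFrom n L v) x
      ∂-label≗promotedLabel L v x with succIn (chainFrom n L v) x
      ... | nothing       = refl
      ... | just nothing  = refl
      ... | just (just y) = refl

  findLabel1-labeling : ∀ {L v} → IsLabeling L → lookup L v ≡ 1 → findLabel1 L (allFin n) ≡ just v
  findLabel1-labeling {L} {v} isLab Lᵥ≡1 = search (allFin n) (∈-allFin v)
    where
    search : ∀ xs → v ∈ xs → findLabel1 L xs ≡ just v
    search (x ∷ xs) v∈ with lookup L x ≡ᵇ 1 in Lₓ≡ᵇ1
    ... | true = cong just (IsLabeling.injective isLab (trans (≡ᵇ⇒≡ _ _ (subst T (sym Lₓ≡ᵇ1) _)) (sym Lᵥ≡1)))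
    ... | false with v∈
    ...   | here refl  = contradiction (≡⇒≡ᵇ _ _ Lᵥ≡1) (subst T Lₓ≡ᵇ1)
    ...   | there v∈xs = search xs v∈xs

  increasing⇒length≤ : ∀ {c} → AllPairs _≺_ c → length c ≤ n
  increasing⇒length≤ {c} inc = subst (length c ≤_) (length-tabulate (λ i → i))
    (⊆⇒length≤ _≟ᶠ_ (AllPairs.map proj₂ inc) (λ {x} _ → ∈-allFin x))

  chainFrom-shape : ∀ {L} k v → ∃ λ t → chainFrom k L v ≡ v ∷ t × AllPairs _≺_ (v ∷ t) ×
                                          (Maximal (last v t) ⊎ length t ≡ k)
  chainFrom-shape         zero    v = [] , refl , [] ∷ [] , inj₂ refl
  chainFrom-shape {L} (suc k) v with minByLabel L (above v) in e
  ... | nothing = [] , refl , [] ∷ [] , inj₁ λ w v≺w → minByLabel-≢nothing (∈-above⁺ v≺w) e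
  ... | just w with t , eq , !wt , end ← chainFrom-shape {L} k w =
    w ∷ t , cong (v ∷_) eq , (v≺w ∷ All.map (≺-trans v≺w) (AllPairs.head !wt)) ∷ !wt , Sum.map₂ (cong suc) end
    where
    v≺w : v ≺ w
    v≺w = ∈-above⁻ (minByLabel-∈ (above v) e)

  ∂-promotes : ∀ {L v} → IsLabeling L → lookup L v ≡ 1 →
               ∃ λ t → ∂ L ≡ promoteAlong L (v ∷ t) × AllPairs _≺_ (v ∷ t) × Maximal (last v t)
  ∂-promotes {L} {v} isLab Lᵥ≡1 with t , eq , inc , end ← chainFrom-shape {L} n v with end
  ... | inj₁ last-max =
    t , trans (∂≡promoteAlong (findLabel1-labeling isLab Lᵥ≡1)) (cong (promoteAlong L) eq) , inc , last-max
  ... | inj₂ |t|≡n    = contradiction (increasing⇒length≤ inc) (<⇒≱ (≤-reflexive (cong suc (sym |t|≡n))))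

  data Greedy (U : Vec ℕ n) : Fin n → List (Fin n) → Set where
    stop : ∀ {v} → Maximal v → Greedy U v []
    step : ∀ {v w t} → v ≺ w → (∀ {y} → v ≺ y → y ≢ w → lookup U w < lookup U y) →
           Greedy U w t → Greedy U v (w ∷ t)

  greedy⇒increasing : ∀ {U v t} → Greedy U v t → AllPairs _≺_ (v ∷ t)
  greedy⇒increasing (stop _)         = [] ∷ []
  greedy⇒increasing (step v≺w _ g) with !wt ← greedy⇒increasing g =
    (v≺w ∷ All.map (≺-trans v≺w) (AllPairs.head !wt)) ∷ !wt

  private
    chainFrom-greedy′ : ∀ {U v t} k → Greedy U v t → length t ≤ k → chainFrom k U v ≡ v ∷ t
    chainFrom-greedy′       zero    (stop _) _ = refl
    chainFrom-greedy′ {U} {v} (suc k) (stop v-max) _ with minByLabel U (above v) in e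
    ... | nothing = refl
    ... | just w  = contradiction (∈-above⁻ (minByLabel-∈ (above v) e)) (v-max w)
    chainFrom-greedy′ {U} {v} (suc k) (step v≺w w-least g) (s≤s |t|≤k)
      rewrite minByLabel-argmin {U} (∈-above⁺ v≺w) (λ y∈ y≢w → w-least (∈-above⁻ y∈) y≢w) =
      cong (v ∷_) (chainFrom-greedy′ k g |t|≤k)

  ∂-greedy : ∀ {U v t} → IsLabeling U → lookup U v ≡ 1 → Greedy U v t → ∂ U ≡ promoteAlong U (v ∷ t)
  ∂-greedy isLab Uᵥ≡1 g = trans (∂≡promoteAlong (findLabel1-labeling isLab Uᵥ≡1))
    (cong (promoteAlong _) (chainFrom-greedy′ n g (≤-trans (n≤1+n _) (increasing⇒length≤ (greedy⇒increasing g)))))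

module Natural {n} (P : FinPoset n) where

  open FinPoset P
  open Order P

  private
    below-count : Fin n → ℕ
    below-count v = length (filter (_≺? v) (allFin n))

    below-count<n : ∀ v → below-count v < n
    below-count<n v = subst (below-count v <_) (length-tabulate (λ i → i))
                            (filter-notAll (_≺? v) (allFin n) (Any.map (λ { refl → ≺-irrefl }) (∈-allFin v)))

    below-count-mono : ∀ {v w} → v ≺ w → below-count v < below-count w
    below-count-mono v≺w = filter-⊂ _≟ᶠ_ (_≺? _) (_≺? _) (Unique.allFin⁺ n) (λ u≺v → ≺-trans u≺v v≺w)
                                    (∈-allFin _) v≺w ≺-irrefl

    -- Lexicographic in (number of elements below, index): injective and strictly monotone.
    key : Fin n → Fin (n * n)
    key v = Fin.combine (Fin.fromℕ< (below-count<n v)) v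

    key-injective : ∀ {v w} → key v ≡ key w → v ≡ w
    key-injective {v} {w} =
      proj₂ ∘ Fin.combine-injective (Fin.fromℕ< (below-count<n v)) v (Fin.fromℕ< (below-count<n w)) w

    key-mono : ∀ {v w} → v ≺ w → key v Fin.< key w
    key-mono {v} {w} v≺w = Fin.combine-monoˡ-< {m = n} v w
      (subst₂ _<_ (sym (Fin.toℕ-fromℕ< _)) (sym (Fin.toℕ-fromℕ< _)) (below-count-mono v≺w))

    rank : Fin n → ℕ
    rank v = suc (length (filter (λ w → key w Fin.<? key v) (allFin n)))

    rank-mono : ∀ {v w} → key v Fin.< key w → rank v < rank w
    rank-mono {v} {w} kv<kw = s≤s (filter-⊂ _≟ᶠ_ (λ u → key u Fin.<? key v) (λ u → key u Fin.<? key w)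
      (Unique.allFin⁺ n) (λ ku<kv → Fin.<-trans ku<kv kv<kw) (∈-allFin v) kv<kw (Fin.<-irrefl refl))

  natural : ∃ λ L → IsLabeling L × (∀ {v w} → v ≺ w → lookup L v < lookup L w)
  natural = tabulate rank , isLabeling-tabulate (λ _ → s≤s z≤n) bounded injective ,
            λ {v} {w} v≺w → subst₂ _<_ (sym (lookup∘tabulate rank v)) (sym (lookup∘tabulate rank w))
                                      (rank-mono (key-mono v≺w))
    where
    bounded : ∀ v → rank v ≤ n
    bounded v = subst (rank v ≤_) (length-tabulate (λ i → i))
      (filter-notAll (λ w → key w Fin.<? key v) (allFin n) (Any.map (λ { refl → Fin.<-irrefl refl }) (∈-allFin v)))
    injective : ∀ {v w} → rank v ≡ rank w → v ≡ w
    injective {v} {w} eq with Fin.<-cmp (key v) (key w)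
    ... | tri< kv<kw _ _ = contradiction eq (<⇒≢ (rank-mono kv<kw))
    ... | tri≈ _ kv≡kw _ = key-injective kv≡kw
    ... | tri> _ _ kw<kv = contradiction (sym eq) (<⇒≢ (rank-mono kw<kv))

module RootedPromotion {m} (P : FinPoset (suc m)) (tree : FinPoset.IsRootedTree P) where

  open FinPoset P
  open Order P
  open RootedTree P tree
  open Chain P
  open Promotion P

  IsRootLabeling : Vec ℕ (suc m) → Set
  IsRootLabeling L = IsLabeling L × lookup L root ≡ suc m

  labelled-one : ∀ {L : Vec ℕ (suc m)} → IsLabeling L → ∃ λ v → lookup L v ≡ 1
  labelled-one isLab = IsLabeling.surjective isLab (s≤s z≤n) (s≤s z≤n)

  ∂-isRootLabeling : ∀ {L} → IsLabeling L → IsRootLabeling (∂ L)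
  ∂-isRootLabeling {L} isLab with v , Lᵥ≡1 ← labelled-one isLab
                             with t , ∂≡ , inc , last-max ← ∂-promotes isLab Lᵥ≡1 =
    subst IsLabeling (sym ∂≡) (promoteAlong-isLabeling !vt isLab Lᵥ≡1) ,
    trans (cong₂ lookup ∂≡ (sym (maximal⇒≡root last-max))) (lookup-promoteAlong-last !vt L)
    where
    !vt : Unique (v ∷ t)
    !vt = AllPairs.map proj₂ inc

  natural⇒root : ∀ {L} → IsLabeling L → (∀ {v w} → v ≺ w → lookup L v < lookup L w) → lookup L root ≡ suc m
  natural⇒root isLab natural with w , Lw≡n ← IsLabeling.surjective isLab (s≤s z≤n) ≤-refl with w ≟ᶠ root
  ... | yes refl    = Lw≡n
  ... | no w≢root = contradiction (subst (_ ≤_) (sym Lw≡n) (IsLabeling.bounded isLab root))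
                                  (<⇒≱ (natural (≺-root w≢root)))

  rootPath : Fin (suc m) → List (Fin (suc m))
  rootPath v with v ≟ᶠ root
  ... | yes _ = []
  ... | no  _ = root ∷ []

  rootPath-unique : ∀ v → Unique (v ∷ rootPath v)
  rootPath-unique v with v ≟ᶠ root
  ... | yes _      = [] ∷ []
  ... | no v≢root = (v≢root ∷ []) ∷ [] ∷ []

  last-rootPath : ∀ v → last v (rootPath v) ≡ root
  last-rootPath v with v ≟ᶠ root
  ... | yes v≡root = v≡root
  ... | no  _      = refl

  demoteAlong-rootPath-isLabeling : ∀ {L} → IsRootLabeling L → ∀ v → IsLabeling (demoteAlong L v (rootPath v))
  demoteAlong-rootPath-isLabeling {L} (isLab , Lroot≡n) v =
    demoteAlong-isLabeling (rootPath-unique v) isLab (trans (cong (lookup L) (last-rootPath v)) Lroot≡n)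

  ∉-rootPath : ∀ {v y} → y ≢ root → y ∉ rootPath v
  ∉-rootPath {v} y≢root with v ≟ᶠ root
  ... | yes _ = λ ()
  ... | no  _ = λ { (here y≡root) → y≢root y≡root }

  rootPath-greedy : ∀ {U v} → (∀ {y} → v ≺ y → y ≢ root → lookup U root < lookup U y) → Greedy U v (rootPath v)
  rootPath-greedy {v = v} root-least with v ≟ᶠ root
  ... | yes refl   = stop root-maximal
  ... | no v≢root = step (≺-root v≢root) root-least (stop root-maximal)

  demoteAlong-rootPath-least : ∀ {L v} → (∀ {y} → v ≺ y → y ≢ root → lookup L v < lookup L y) →
    ∀ {y} → v ≺ y → y ≢ root → lookup (demoteAlong L v (rootPath v)) root < lookup (demoteAlong L v (rootPath v)) y
  demoteAlong-rootPath-least {L} {v} v-least {y} v≺y y≢root with v ≟ᶠ root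
  ... | yes refl   = contradiction v≺y (root-maximal y)
  ... | no v≢root = subst₂ _<_
    (sym (trans (lookup-demoteAlong L (v≢root ∘ sym)) (cong (suc ∘ lookup L) (prev-here v root []))))
    (sym (lookup-demoteAlong-∉ L λ { (here y≡v) → proj₂ v≺y (sym y≡v) ; (there (here y≡root)) → y≢root y≡root }))
    (s≤s (v-least v≺y y≢root))

  rootPromotion : Vec ℕ (suc m) → Vec ℕ (suc m)
  rootPromotion L with findLabel1 L (allFin (suc m))
  ... | nothing = L
  ... | just v  = promoteAlong L (v ∷ rootPath v)

  rootPromotion-isRootLabeling : ∀ {L} → IsLabeling L → IsRootLabeling (rootPromotion L)
  rootPromotion-isRootLabeling {L} isLab with v , Lᵥ≡1 ← labelled-one isLab
    rewrite findLabel1-labeling isLab Lᵥ≡1 =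
    promoteAlong-isLabeling (rootPath-unique v) isLab Lᵥ≡1 ,
    trans (cong (lookup (promoteAlong L (v ∷ rootPath v))) (sym (last-rootPath v))) (lookup-promoteAlong-last (rootPath-unique v) L)

  rootPromotion-demoteAlong : ∀ {L} → IsRootLabeling L → ∀ v → rootPromotion (demoteAlong L v (rootPath v)) ≡ L
  rootPromotion-demoteAlong {L} rootLab@(_ , Lroot≡n) v
    rewrite findLabel1-labeling {v = v} (demoteAlong-rootPath-isLabeling rootLab v) (lookup-demoteAlong-head L v (rootPath v)) =
    promoteAlong-demoteAlong (rootPath-unique v) {L} (trans (cong (lookup L) (last-rootPath v)) Lroot≡n)

  -- Undoing the promotion of a natural labeling L along x, z, root gives a labeling that ∂ maps to L
  -- but that is not of the form demoteAlong L v (rootPath v).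
  module ThreeChain {L x z} (L-natural : ∀ {v w} → v ≺ w → lookup L v < lookup L w)
                    (x≺z : x ≺ z) (z≺root : z ≺ root) where

    U : Vec ℕ (suc m)
    U = demoteAlong L x (z ∷ root ∷ [])

    unique : Unique (x ∷ z ∷ root ∷ [])
    unique = AllPairs.map proj₂ ((x≺z ∷ ≺-trans x≺z z≺root ∷ []) ∷ (z≺root ∷ []) ∷ [] ∷ [])

    private
      U-z : lookup U z ≡ suc (lookup L x)
      U-z = trans (lookup-demoteAlong L (proj₂ x≺z ∘ sym)) (cong (suc ∘ lookup L) (prev-here x z _))

      U-root : lookup U root ≡ suc (lookup L z)
      U-root = trans (lookup-demoteAlong L (proj₂ (≺-trans x≺z z≺root) ∘ sym))
                     (cong (suc ∘ lookup L) (trans (prev-there (proj₂ z≺root)) (prev-here z root [])))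

      U-other : ∀ {y} → y ≢ x → y ≢ z → y ≢ root → lookup U y ≡ suc (lookup L y)
      U-other y≢x y≢z y≢root = lookup-demoteAlong-∉ L λ
        { (here y≡x)                 → y≢x y≡x
        ; (there (here y≡z))         → y≢z y≡z
        ; (there (there (here y≡root))) → y≢root y≡root
        }

    greedy : Greedy U x (z ∷ root ∷ [])
    greedy = step x≺z z-least (step z≺root root-least (stop root-maximal))
      where
      z-least : ∀ {y} → x ≺ y → y ≢ z → lookup U z < lookup U y
      z-least {y} x≺y y≢z with y ≟ᶠ root
      ... | yes refl   = subst₂ _<_ (sym U-z) (sym U-root) (s≤s (L-natural x≺z))
      ... | no y≢root = subst₂ _<_ (sym U-z) (sym (U-other (proj₂ x≺y ∘ sym) y≢z y≢root)) (s≤s (L-natural x≺y))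
      root-least : ∀ {y} → z ≺ y → y ≢ root → lookup U root < lookup U y
      root-least {y} z≺y y≢root =
        subst₂ _<_ (sym U-root) (sym (U-other y≢x (proj₂ z≺y ∘ sym) y≢root)) (s≤s (L-natural z≺y))
        where
        y≢x : y ≢ x
        y≢x refl = ≺-asym x≺z z≺y

    demotion≢rootDemotion : IsLabeling L → ∀ v → U ≢ demoteAlong L v (rootPath v)
    demotion≢rootDemotion isLab v U≡D =
      demotion≢xDemotion (subst (λ w → U ≡ demoteAlong L w (rootPath w)) (sym x≡v) U≡D)
      where
      x≡v : x ≡ v
      x≡v = IsLabeling.injective (demoteAlong-rootPath-isLabeling (isLab , natural⇒root isLab L-natural) v)
        (trans (cong (λ M → lookup M x) (sym U≡D)) (trans (lookup-demoteAlong-head L x _) (sym (lookup-demoteAlong-head L v _))))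
      demotion≢xDemotion : U ≢ demoteAlong L x (rootPath x)
      demotion≢xDemotion U≡D′ = proj₂ x≺z (IsLabeling.injective isLab (suc-injective (begin
        suc (lookup L x)                             ≡⟨ U-z ⟨
        lookup U z                                   ≡⟨ cong (λ M → lookup M z) U≡D′ ⟩
        lookup (demoteAlong L x (rootPath x)) z      ≡⟨ lookup-demoteAlong-∉ L z∉ ⟩
        suc (lookup L z)                             ∎)))
        where
        open ≡-Reasoning
        z∉ : z ∉ x ∷ rootPath x
        z∉ (here z≡x) = proj₂ x≺z (sym z≡x)
        z∉ (there z∈) = ∉-rootPath (proj₂ z≺root) z∈

module Degree {m} (P : FinPoset (suc m)) (tree : FinPoset.IsRootedTree P) where

  open FinPoset P
  open Order P
  open RootedTree P tree
  open Chain P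
  open Promotion P
  open RootedPromotion P tree

  private
    n : ℕ
    n = suc m

    _≟ᵛ_ : DecidableEquality (Vec ℕ n)
    _≟ᵛ_ = ≡-dec _≟_

  Λᵣ : List (Vec ℕ n)
  Λᵣ = filter (λ L → lookup L root Data.Nat.≟ n) (Λ n)

  ∈-Λᵣ⁺ : ∀ {L} → IsRootLabeling L → L ∈ Λᵣ
  ∈-Λᵣ⁺ (isLab , Lroot≡n) = ∈-filter⁺ _ (∈-Λ⁺ isLab) Lroot≡n

  ∈-Λᵣ⁻ : ∀ {L} → L ∈ Λᵣ → IsRootLabeling L
  ∈-Λᵣ⁻ L∈Λᵣ = let L∈Λ , Lroot≡n = ∈-filter⁻ _ {xs = Λ n} L∈Λᵣ in ∈-Λ⁻ L∈Λ , Lroot≡n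

  Λᵣ-unique : Unique Λᵣ
  Λᵣ-unique = Unique.filter⁺ _ (Λ-unique n)

  #∂⁻¹ : Vec ℕ n → ℕ
  #∂⁻¹ = preimageSize ∂ (Λ n)

  sum-#∂⁻¹ : sum (map #∂⁻¹ Λᵣ) ≡ length (Λ n)
  sum-#∂⁻¹ = sum-preimage _≟ᵛ_ ∂ (Λ n) Λᵣ-unique (∈-Λᵣ⁺ ∘ ∂-isRootLabeling ∘ ∈-Λ⁻)

  degNumerator-Λᵣ : degNumerator ∂ (Λ n) ≡ sum (map (λ L → #∂⁻¹ L * #∂⁻¹ L) Λᵣ)
  degNumerator-Λᵣ = sym (sum-map-filter _ (λ L → #∂⁻¹ L * #∂⁻¹ L) (Λ n) λ _ Lroot≢n →
    cong (λ k → k * k) (cong length (preimage-∉ _≟ᵛ_ ∂ λ y∈Λ ∂y≡L →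
      Lroot≢n (subst (λ M → lookup M root ≡ n) ∂y≡L (proj₂ (∂-isRootLabeling (∈-Λ⁻ y∈Λ)))))))

  rootDemotions : Vec ℕ n → List (Vec ℕ n)
  rootDemotions L = map (λ v → demoteAlong L v (rootPath v)) (allFin n)

  module _ {L} (rootLab : IsRootLabeling L) where

    rootDemotions-unique : Unique (rootDemotions L)
    rootDemotions-unique = Unique.map⁺ injective (Unique.allFin⁺ n)
      where
      injective : ∀ {v w} → demoteAlong L v (rootPath v) ≡ demoteAlong L w (rootPath w) → v ≡ w
      injective {v} {w} eq = IsLabeling.injective (demoteAlong-rootPath-isLabeling rootLab w)
        (trans (cong (λ M → lookup M v) (sym eq)) (trans (lookup-demoteAlong-head L v _) (sym (lookup-demoteAlong-head L w _))))

    rootDemotions⊆preimage : ∀ {f} → (∀ v → f (demoteAlong L v (rootPath v)) ≡ L) →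
                             rootDemotions L ⊆ preimage _≟ᵛ_ f (Λ n) L
    rootDemotions⊆preimage f-demote d∈
      with v , _ , refl ← ∈-map⁻ (λ v → demoteAlong L v (rootPath v)) {xs = allFin n} d∈ =
      ∈-filter⁺ _ (∈-Λ⁺ (demoteAlong-rootPath-isLabeling rootLab v)) (f-demote v)

    length-rootDemotions : length (rootDemotions L) ≡ n
    length-rootDemotions = trans (length-map _ (allFin n)) (length-tabulate (λ i → i))

    n≤|preimage| : ∀ {f} → (∀ v → f (demoteAlong L v (rootPath v)) ≡ L) → n ≤ length (preimage _≟ᵛ_ f (Λ n) L)
    n≤|preimage| {f} f-demote = subst (_≤ length (preimage _≟ᵛ_ f (Λ n) L)) length-rootDemotions
      (⊆⇒length≤ _≟ᵛ_ rootDemotions-unique (rootDemotions⊆preimage f-demote))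

    ∂-demoteAlong-rootPath : (∀ {v y} → v ≺ y → y ≢ root → lookup L v < lookup L y) →
                             ∀ v → ∂ (demoteAlong L v (rootPath v)) ≡ L
    ∂-demoteAlong-rootPath L-least v = trans
      (∂-greedy (demoteAlong-rootPath-isLabeling rootLab v) (lookup-demoteAlong-head L v _)
                (rootPath-greedy (demoteAlong-rootPath-least L-least)))
      (promoteAlong-demoteAlong (rootPath-unique v) (trans (cong (lookup L) (last-rootPath v)) (proj₂ rootLab)))

  n*|Λᵣ|≤Σ#∂⁻¹ : n * length Λᵣ ≤ sum (map #∂⁻¹ Λᵣ)
  n*|Λᵣ|≤Σ#∂⁻¹ = begin
    n * length Λᵣ                                             ≡⟨ sum-map-const n Λᵣ ⟨
    sum (map (λ _ → n) Λᵣ)                                    ≤⟨ sum-map-mono-≤ Λᵣ (λ L∈Λᵣ →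
                                                                   n≤|preimage| (∈-Λᵣ⁻ L∈Λᵣ) (rootPromotion-demoteAlong (∈-Λᵣ⁻ L∈Λᵣ))) ⟩
    sum (map (length ∘ preimage _≟ᵛ_ rootPromotion (Λ n)) Λᵣ) ≡⟨ sum-preimage _≟ᵛ_ rootPromotion (Λ n) Λᵣ-unique
                                                                   (∈-Λᵣ⁺ ∘ rootPromotion-isRootLabeling ∘ ∈-Λ⁻) ⟩
    length (Λ n)                                              ≡⟨ sum-#∂⁻¹ ⟨
    sum (map #∂⁻¹ Λᵣ)                                         ∎
    where open ≤-Reasoning

  n*|Λ|≤degNumerator : n * length (Λ n) ≤ degNumerator ∂ (Λ n)
  n*|Λ|≤degNumerator =
    subst₂ _≤_ (cong (n *_) sum-#∂⁻¹) (sym degNumerator-Λᵣ) (sum-squares-≥ #∂⁻¹ n Λᵣ n*|Λᵣ|≤Σ#∂⁻¹)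

  #∂⁻¹-flat : Flat → ∀ {L} → L ∈ Λᵣ → #∂⁻¹ L ≡ n
  #∂⁻¹-flat flat {L} L∈Λᵣ = ≤-antisym
    (subst (#∂⁻¹ L ≤_) (length-rootDemotions rootLab) (⊆⇒length≤ _≟ᵛ_ (Unique.filter⁺ _ (Λ-unique n)) preimage⊆))
    (n≤|preimage| rootLab (∂-demoteAlong-rootPath rootLab λ v≺y y≢root → contradiction (flat v≺y) y≢root))
    where
    rootLab = ∈-Λᵣ⁻ L∈Λᵣ
    preimage⊆ : preimage _≟ᵛ_ ∂ (Λ n) L ⊆ rootDemotions L
    preimage⊆ {y} y∈ with y∈Λ , refl ← ∈-filter⁻ _ {xs = Λ n} y∈
                      with v , yᵥ≡1 ← labelled-one (∈-Λ⁻ y∈Λ) =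
      subst (_∈ rootDemotions (∂ y)) demotion≡y (∈-map⁺ (λ v → demoteAlong (∂ y) v (rootPath v)) (∈-allFin v))
      where
      demotion≡y : demoteAlong (∂ y) v (rootPath v) ≡ y
      demotion≡y = trans
        (cong (λ M → demoteAlong M v (rootPath v))
              (∂-greedy (∈-Λ⁻ y∈Λ) yᵥ≡1 (rootPath-greedy λ v≺w w≢root → contradiction (flat v≺w) w≢root)))
        (demoteAlong-promoteAlong (rootPath-unique v) (∈-Λ⁻ y∈Λ) yᵥ≡1)

  #∂⁻¹-natural : ∀ {x z} → x ≺ z → z ≺ root → ∃ λ L → L ∈ Λᵣ × n < #∂⁻¹ L
  #∂⁻¹-natural {x} x≺z z≺root with L , isLab , L-natural ← Natural.natural P = L , ∈-Λᵣ⁺ rootLab , n<#∂⁻¹L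
    where
    open ThreeChain {L} L-natural x≺z z≺root
    rootLab : IsRootLabeling L
    rootLab = isLab , natural⇒root isLab L-natural
    ∂U≡L : ∂ U ≡ L
    ∂U≡L = trans (∂-greedy (demoteAlong-isLabeling unique isLab (proj₂ rootLab)) (lookup-demoteAlong-head L x _) greedy)
                 (promoteAlong-demoteAlong unique (proj₂ rootLab))
    U∉ : All (U ≢_) (rootDemotions L)
    U∉ = All.tabulate λ d∈ → let v , _ , d≡ = ∈-map⁻ (λ v → demoteAlong L v (rootPath v)) {xs = allFin n} d∈ in
                              subst (U ≢_) (sym d≡) (demotion≢rootDemotion isLab v)
    n<#∂⁻¹L : n < #∂⁻¹ L
    n<#∂⁻¹L = subst (_≤ #∂⁻¹ L) (cong suc (length-rootDemotions rootLab))
      (⊆⇒length≤ _≟ᵛ_ (U∉ ∷ rootDemotions-unique rootLab) λ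
        { (here refl) → ∈-filter⁺ _ (∈-Λ⁺ (demoteAlong-isLabeling unique isLab (proj₂ rootLab))) ∂U≡L
        ; (there d∈)  → rootDemotions⊆preimage rootLab (∂-demoteAlong-rootPath rootLab λ v≺y _ → L-natural v≺y) d∈ })

  flat⇒equality : Flat → n * length (Λ n) ≡ degNumerator ∂ (Λ n)
  flat⇒equality flat =
    trans (cong (n *_) (sym sum-#∂⁻¹)) (sym (trans degNumerator-Λᵣ (sum-squares-≡ #∂⁻¹ n Λᵣ (#∂⁻¹-flat flat))))

  non-flat⇒< : ∀ {u w} → u ≺ w → w ≢ root → n * length (Λ n) < degNumerator ∂ (Λ n)
  non-flat⇒< u≺w w≢root = let L , L∈Λᵣ , n<#∂⁻¹L = #∂⁻¹-natural u≺w (≺-root w≢root) in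
    subst₂ _<_ (cong (n *_) sum-#∂⁻¹) (sym degNumerator-Λᵣ)
               (sum-squares-> #∂⁻¹ n Λᵣ n*|Λᵣ|≤Σ#∂⁻¹ L∈Λᵣ (>⇒≢ n<#∂⁻¹L))

  equality⇒flat : n * length (Λ n) ≡ degNumerator ∂ (Λ n) → Flat
  equality⇒flat eq {w = w} u≺w = decidable-stable (w ≟ᶠ root) λ w≢root → <⇒≢ (non-flat⇒< u≺w w≢root) eq

theorem3p7 : (m : ℕ) (P : FinPoset (suc m)) → FinPoset.IsRootedTree P →
    (suc m * length (Λ (suc m)) ≤ degNumerator (FinPoset.∂ P) (Λ (suc m)))
    × ((suc m * length (Λ (suc m)) ≡ degNumerator (FinPoset.∂ P) (Λ (suc m)))
       ⇔ FinPoset.IsRootedStar P)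
theorem3p7 m P tree = n*|Λ|≤degNumerator , mk⇔ (flat⇒star ∘ equality⇒flat) (flat⇒equality ∘ star⇒flat)
  where
  open RootedTree P tree
  open Degree P tree
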